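{- Let $\mathsf{M}$ be a matroid of rank $k$ on $E$ with rank function $\operatorname{rk}$, let $H$ be a stressed hyperplane of $\mathsf{M}$, and let $\widetilde{\mathsf{M}}$ be the relaxation of $\mathsf{M}$ at $H$, with rank function $\widetilde{\operatorname{rk}}$. Then for every $A\subseteq E$, \[ \widetilde{\operatorname{rk}}(A)=\begin{cases}\operatorname{rk}(A)+1 & \text{if } A\subseteq H \text{ and } |A|\geq k,\\ \operatorname{rk}(A) & \text{otherwise.}\end{cases}\]
   Context: A hyperplane of a matroid of rank $k$ is a flat of rank $k-1$; it is stressed if all its subsets of cardinality $k$ are circuits. If $\mathsf{M}=(E,\mathscr{B})$ has a stressed hyperplane $H$, the relaxation of $\mathsf{M}$ at $H$ is the matroid $\widetilde{\mathsf{M}}=(E,\mathscr{B}\sqcup\{S\subseteq H:|S|=k\})$. -}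

module Defs where

open import Level using (0ℓ)
open import Data.Nat using (ℕ; suc; _≤_; _<_)
open import Data.Fin using (Fin)
open import Data.Fin.Subset using (Subset; _∈_; _∉_; _⊆_; _⊂_; _∩_; _∪_; ⁅_⁆; ∣_∣; _─_)
open import Data.Product using (Σ; ∃; ∃-syntax; _×_; _,_)
open import Data.Sum using (_⊎_)
open import Relation.Nullary using (¬_)
open import Relation.Binary.PropositionalEquality using (_≡_)

Family : ℕ → Set₁
Family n = Subset n → Set

record Matroid (n : ℕ) : Set₁ where
  field
    IsBasis    : Family n
    nonempty   : ∃[ B ] IsBasis B
    exchange   : ∀ {B₁ B₂} → IsBasis B₁ → IsBasis B₂ →
                 ∀ {x} → x ∈ B₁ → x ∉ B₂ →
                 ∃[ y ] (y ∈ B₂ × y ∉ B₁ × IsBasis ((B₁ ─ ⁅ x ⁆) ∪ ⁅ y ⁆))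
open Matroid public

-- Rank of A with respect to a basis family: max |A ∩ B| over bases B.
-- (For a matroid this is the usual rank function: the largest size of an
-- independent subset of A.)  Stated relationally: "r is the rank of A".
IsRankOf : ∀ {n} → Family n → Subset n → ℕ → Set
IsRankOf 𝓑 A r = (∃[ B ] (𝓑 B × ∣ A ∩ B ∣ ≡ r)) × (∀ B → 𝓑 B → ∣ A ∩ B ∣ ≤ r)

HasRank : ∀ {n} → Matroid n → ℕ → Set
HasRank {n} M k = IsRankOf (IsBasis M) (Data.Fin.Subset.⊤) k

Independent : ∀ {n} → Matroid n → Subset n → Set
Independent M I = ∃[ B ] (IsBasis M B × I ⊆ B)

Dependent : ∀ {n} → Matroid n → Subset n → Set
Dependent M C = ¬ Independent M C

IsCircuit : ∀ {n} → Matroid n → Subset n → Set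
IsCircuit M C = Dependent M C × (∀ D → D ⊂ C → Independent M D)

IsFlat : ∀ {n} → Matroid n → Subset n → Set
IsFlat M F = ∀ x → x ∉ F → ∀ r s →
  IsRankOf (IsBasis M) F r → IsRankOf (IsBasis M) (F ∪ ⁅ x ⁆) s → r < s

IsHyperplane : ∀ {n} → Matroid n → ℕ → Subset n → Set
IsHyperplane M k H = IsFlat M H × ∃[ r ] (suc r ≡ k × IsRankOf (IsBasis M) H r)

IsStressedHyperplane : ∀ {n} → Matroid n → ℕ → Subset n → Set
IsStressedHyperplane M k H =
  IsHyperplane M k H × (∀ S → S ⊆ H → ∣ S ∣ ≡ k → IsCircuit M S)

RelaxedBases : ∀ {n} → Matroid n → ℕ → Subset n → Family n
RelaxedBases M k H S = IsBasis M S ⊎ (S ⊆ H × ∣ S ∣ ≡ k)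

-- The only new bases are the k-subsets of H, so only sets containing one of them
-- can change rank. A k-subset S of H is a circuit, so S minus a point is an
-- independent set of size k - 1 inside the hyperplane H, hence spans it. If A ⊆ H,
-- this shows rk A = k - 1, and the new basis S ⊆ A raises the rank to k. If A
-- contains S and a point x ∉ H, then S minus a point together with x is already
-- independent, so rk A = k and nothing changes. Otherwise every new basis meets A in
-- a proper subset of a circuit, which is independent in M.
module Submission where

open import Defs
open import Data.Nat using (ℕ; zero; suc; _≤_; _<_; _≤?_; s≤s; z≤n)
open import Data.Nat.Properties
  using ( ≤-refl; ≤-trans; ≤-antisym; ≤-reflexive; <-≤-trans; ≤-<-trans; ≤-pred
        ; n≤1+n; 1+n≰n; ≰⇒>; suc-injective; module ≤-Reasoning )
open import Data.Fin using (Fin; zero; suc)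
open import Data.Fin.Properties using (any?)
open import Data.Vec using (_∷_; here; there)
open import Data.Fin.Subset
open import Data.Fin.Subset.Properties
open import Data.Product using (_×_; _,_; proj₁; proj₂; ∃-syntax)
open import Data.Sum using (_⊎_; inj₁; inj₂; [_,_])
open import Data.Empty using (⊥-elim)
open import Function using (_∘_)
open import Relation.Nullary using (¬_; yes; no; contradiction)
open import Relation.Nullary.Decidable using (decidable-stable; ¬?; _×-dec_)
open import Relation.Binary.PropositionalEquality using (_≡_; _≢_; refl; sym; trans; cong; subst)

private
  variable
    n r s : ℕ
    p q : Subset n
    x : Fin n

⊆⊎∃∈∉ : (p q : Subset n) → p ⊆ q ⊎ ∃[ x ] (x ∈ p × x ∉ q)
⊆⊎∃∈∉ p q with any? (λ x → x ∈? p ×-dec ¬? (x ∈? q))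
... | yes (x , x∈p , x∉q) = inj₂ (x , x∈p , x∉q)
... | no ∄ = inj₁ λ {x} x∈p → decidable-stable (x ∈? q) (λ x∉q → ∄ (x , x∈p , x∉q))

x∉p∧x∉q⇒x∉p∪q : x ∉ p → x ∉ q → x ∉ p ∪ q
x∉p∧x∉q⇒x∉p∪q x∉p x∉q = [ x∉p , x∉q ] ∘ x∈p∪q⁻ _ _

x∈p─q⇒x∉q : x ∈ p ─ q → x ∉ q
x∈p─q⇒x∉q {p = _ ∷ p} {q = outside ∷ q} (there x∈p─q) (there x∈q) = x∈p─q⇒x∉q x∈p─q x∈q
x∈p─q⇒x∉q {p = _ ∷ p} {q = inside  ∷ q} (there x∈p─q) (there x∈q) = x∈p─q⇒x∉q x∈p─q x∈q

p⊆q∧x∈q⇒p∪⁅x⁆⊆q : p ⊆ q → x ∈ q → p ∪ ⁅ x ⁆ ⊆ q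
p⊆q∧x∈q⇒p∪⁅x⁆⊆q {p = p} {x = x} p⊆q x∈q y∈p∪x with x∈p∪q⁻ p ⁅ x ⁆ y∈p∪x
... | inj₁ y∈p = p⊆q y∈p
... | inj₂ y∈⁅x⁆ rewrite x∈⁅y⁆⇒x≡y x y∈⁅x⁆ = x∈q

p⊆q⇒p∩r⊆q∩r : p ⊆ q → ∀ r → p ∩ r ⊆ q ∩ r
p⊆q⇒p∩r⊆q∩r {p = p} p⊆q r x∈p∩r =
  let x∈p , x∈r = x∈p∩q⁻ p r x∈p∩r in x∈p∩q⁺ (p⊆q x∈p , x∈r)

∣q∣≤∣p∩q∣⇒q⊆p : ∣ q ∣ ≤ ∣ p ∩ q ∣ → q ⊆ p
∣q∣≤∣p∩q∣⇒q⊆p {q = q} {p = p} ∣q∣≤∣p∩q∣ {x} x∈q = decidable-stable (x ∈? p) λ x∉p →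
  1+n≰n (≤-trans (p⊂q⇒∣p∣<∣q∣ (p∩q⊆q p q , x , x∈q , x∉p ∘ proj₁ ∘ x∈p∩q⁻ p q)) ∣q∣≤∣p∩q∣)

p⊆q⇒∣q∩p∣≡∣p∣ : p ⊆ q → ∣ q ∩ p ∣ ≡ ∣ p ∣
p⊆q⇒∣q∩p∣≡∣p∣ {p = p} {q = q} p⊆q =
  ≤-antisym (∣p∩q∣≤∣q∣ q p) (p⊆q⇒∣p∣≤∣q∣ (λ x∈p → x∈p∩q⁺ (p⊆q x∈p , x∈p)))

0<∣p∣⇒Nonempty : 0 < ∣ p ∣ → Nonempty p
0<∣p∣⇒Nonempty {p = inside  ∷ p} _ = zero , here
0<∣p∣⇒Nonempty {p = outside ∷ p} 0<∣p∣ =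
  let x , x∈p = 0<∣p∣⇒Nonempty 0<∣p∣ in suc x , there x∈p

∣p∪⁅x⁆∣≡1+∣p∣ : x ∉ p → ∣ p ∪ ⁅ x ⁆ ∣ ≡ suc ∣ p ∣
∣p∪⁅x⁆∣≡1+∣p∣ {x = zero}  {p = outside ∷ p} _   = cong (suc ∘ ∣_∣) (∪-identityʳ p)
∣p∪⁅x⁆∣≡1+∣p∣ {x = zero}  {p = inside  ∷ p} x∉p = contradiction here x∉p
∣p∪⁅x⁆∣≡1+∣p∣ {x = suc x} {p = outside ∷ p} x∉p = ∣p∪⁅x⁆∣≡1+∣p∣ (x∉p ∘ there)
∣p∪⁅x⁆∣≡1+∣p∣ {x = suc x} {p = inside  ∷ p} x∉p = cong suc (∣p∪⁅x⁆∣≡1+∣p∣ (x∉p ∘ there))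

x∈p⇒1+∣p-x∣≡∣p∣ : x ∈ p → suc ∣ p - x ∣ ≡ ∣ p ∣
x∈p⇒1+∣p-x∣≡∣p∣ {p = inside  ∷ p} here          = cong (suc ∘ ∣_∣) (p─⊥≡p p)
x∈p⇒1+∣p-x∣≡∣p∣ {p = inside  ∷ p} (there x∈p) = cong suc (x∈p⇒1+∣p-x∣≡∣p∣ x∈p)
x∈p⇒1+∣p-x∣≡∣p∣ {p = outside ∷ p} (there x∈p) = x∈p⇒1+∣p-x∣≡∣p∣ x∈p

s≤∣p∣⇒∃q⊆p∧∣q∣≡s : ∀ {n s} {p : Subset n} → s ≤ ∣ p ∣ → ∃[ q ] (q ⊆ p × ∣ q ∣ ≡ s)
s≤∣p∣⇒∃q⊆p∧∣q∣≡s {n = n} {s = zero} _ = ⊥ , (λ x∈⊥ → contradiction x∈⊥ ∉⊥) , ∣⊥∣≡0 n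
s≤∣p∣⇒∃q⊆p∧∣q∣≡s {s = suc s} {p = outside ∷ p} s≤∣p∣ =
  let q , q⊆p , ∣q∣≡s = s≤∣p∣⇒∃q⊆p∧∣q∣≡s s≤∣p∣ in outside ∷ q , out⊆ q⊆p , ∣q∣≡s
s≤∣p∣⇒∃q⊆p∧∣q∣≡s {s = suc s} {p = inside ∷ p} (s≤s s≤∣p∣) =
  let q , q⊆p , ∣q∣≡s = s≤∣p∣⇒∃q⊆p∧∣q∣≡s s≤∣p∣ in inside ∷ q , in⊆in q⊆p , cong suc ∣q∣≡s

module _ {𝓑 : Family n} {A A′ : Subset n} where

  IsRankOf-mono : IsRankOf 𝓑 A r → IsRankOf 𝓑 A′ s → A ⊆ A′ → r ≤ s
  IsRankOf-mono {r = r} {s = s} ((B , B∈𝓑 , ∣A∩B∣≡r) , _) (_ , ≤s) A⊆A′ = begin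
    r           ≡⟨ sym ∣A∩B∣≡r ⟩
    ∣ A ∩ B ∣   ≤⟨ p⊆q⇒∣p∣≤∣q∣ (p⊆q⇒p∩r⊆q∩r A⊆A′ B) ⟩
    ∣ A′ ∩ B ∣  ≤⟨ ≤s B B∈𝓑 ⟩
    s           ∎
    where open ≤-Reasoning

  IsRankOf-⊇ : IsRankOf 𝓑 A r → A ⊆ A′ → (∀ B → 𝓑 B → ∣ A′ ∩ B ∣ ≤ r) → IsRankOf 𝓑 A′ r
  IsRankOf-⊇ ((B , B∈𝓑 , ∣A∩B∣≡r) , _) A⊆A′ ≤r =
    (B , B∈𝓑 , ≤-antisym (≤r B B∈𝓑)
                 (subst (_≤ ∣ A′ ∩ B ∣) ∣A∩B∣≡r (p⊆q⇒∣p∣≤∣q∣ (p⊆q⇒p∩r⊆q∩r A⊆A′ B))))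
    , ≤r

module _ (M : Matroid n) where

  independent⇒∣∣≤rank : ∀ {A I} → IsRankOf (IsBasis M) A r → Independent M I → I ⊆ A → ∣ I ∣ ≤ r
  independent⇒∣∣≤rank (_ , ≤r) (B , isB , I⊆B) I⊆A =
    ≤-trans (p⊆q⇒∣p∣≤∣q∣ (λ x∈I → x∈p∩q⁺ (I⊆A x∈I , I⊆B x∈I))) (≤r B isB)

  exchange-shrinks-difference : ∀ {B₁ B₂} → IsBasis M B₁ → IsBasis M B₂ → x ∈ B₁ → x ∉ B₂ →
    ∃[ B ] (IsBasis M B × ∣ B ∣ ≡ ∣ B₁ ∣ × ∣ B ─ B₂ ∣ < ∣ B₁ ─ B₂ ∣)
  exchange-shrinks-difference {x = x} {B₁} {B₂} isB₁ isB₂ x∈B₁ x∉B₂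
    with exchange M isB₁ isB₂ x∈B₁ x∉B₂
  ... | y , y∈B₂ , y∉B₁ , isB =
    (B₁ - x) ∪ ⁅ y ⁆ , isB , ∣B∣≡∣B₁∣ , ≤-<-trans (p⊆q⇒∣p∣≤∣q∣ B─B₂⊆B₁─B₂-x) ∣B₁─B₂-x∣<∣B₁─B₂∣
    where
    ∣B∣≡∣B₁∣ : ∣ (B₁ - x) ∪ ⁅ y ⁆ ∣ ≡ ∣ B₁ ∣
    ∣B∣≡∣B₁∣ = trans (∣p∪⁅x⁆∣≡1+∣p∣ (y∉B₁ ∘ p─q⊆p B₁ ⁅ x ⁆)) (x∈p⇒1+∣p-x∣≡∣p∣ x∈B₁)
    ∣B₁─B₂-x∣<∣B₁─B₂∣ : ∣ (B₁ ─ B₂) - x ∣ < ∣ B₁ ─ B₂ ∣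
    ∣B₁─B₂-x∣<∣B₁─B₂∣ = x∈p⇒∣p-x∣<∣p∣ (x∈p∧x∉q⇒x∈p─q x∈B₁ x∉B₂)
    B─B₂⊆B₁─B₂-x : (B₁ - x) ∪ ⁅ y ⁆ ─ B₂ ⊆ (B₁ ─ B₂) - x
    B─B₂⊆B₁─B₂-x w∈B─B₂ with x∈p∪q⁻ (B₁ - x) ⁅ y ⁆ (p─q⊆p _ B₂ w∈B─B₂)
    ... | inj₁ w∈B₁-x = x∈p∧x∉q⇒x∈p─q (x∈p∧x∉q⇒x∈p─q (p─q⊆p B₁ ⁅ x ⁆ w∈B₁-x) (x∈p─q⇒x∉q w∈B─B₂))
                                       (x∈p─q⇒x∉q w∈B₁-x)
    ... | inj₂ w∈⁅y⁆ rewrite x∈⁅y⁆⇒x≡y y w∈⁅y⁆ = contradiction y∈B₂ (x∈p─q⇒x∉q w∈B─B₂)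

  ∣basis∣≤∣basis∣ : ∀ {B₁ B₂} → IsBasis M B₁ → IsBasis M B₂ → ∣ B₁ ∣ ≤ ∣ B₂ ∣
  ∣basis∣≤∣basis∣ {B₁} {B₂} isB₁ isB₂ = go (suc ∣ B₁ ─ B₂ ∣) isB₁ ≤-refl
    where
    go : ∀ d {B} → IsBasis M B → ∣ B ─ B₂ ∣ < d → ∣ B ∣ ≤ ∣ B₂ ∣
    go (suc d) {B} isB ∣B─B₂∣<1+d with ⊆⊎∃∈∉ B B₂
    ... | inj₁ B⊆B₂ = p⊆q⇒∣p∣≤∣q∣ B⊆B₂
    ... | inj₂ (x , x∈B , x∉B₂) =
      let B′ , isB′ , ∣B′∣≡∣B∣ , shrinks = exchange-shrinks-difference isB isB₂ x∈B x∉B₂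
      in subst (_≤ ∣ B₂ ∣) ∣B′∣≡∣B∣ (go d isB′ (<-≤-trans shrinks (≤-pred ∣B─B₂∣<1+d)))

  ∣basis∣≡rank : ∀ {k B} → HasRank M k → IsBasis M B → ∣ B ∣ ≡ k
  ∣basis∣≡rank {k} {B} ((B₀ , isB₀ , ∣⊤∩B₀∣≡k) , ≤k) isB = ≤-antisym ∣B∣≤k k≤∣B∣
    where
    open ≤-Reasoning
    ∣B∣≤k : ∣ B ∣ ≤ k
    ∣B∣≤k = subst (_≤ k) (cong ∣_∣ (∩-identityˡ B)) (≤k B isB)
    k≤∣B∣ : k ≤ ∣ B ∣
    k≤∣B∣ = begin
      k           ≡⟨ sym ∣⊤∩B₀∣≡k ⟩
      ∣ ⊤ ∩ B₀ ∣  ≡⟨ cong ∣_∣ (∩-identityˡ B₀) ⟩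
      ∣ B₀ ∣      ≤⟨ ∣basis∣≤∣basis∣ isB₀ isB ⟩
      ∣ B ∣       ∎

  exchange-extends : ∀ {B₁ B₂ I} → IsBasis M B₁ → IsBasis M B₂ → I ⊆ B₁ →
    x ∈ B₁ → x ∉ I → x ∉ B₂ → ∃[ y ] (y ∈ B₂ × y ∉ I × Independent M (I ∪ ⁅ y ⁆))
  exchange-extends {x = x} {B₁} {I = I} isB₁ isB₂ I⊆B₁ x∈B₁ x∉I x∉B₂
    with exchange M isB₁ isB₂ x∈B₁ x∉B₂
  ... | y , y∈B₂ , y∉B₁ , isB =
    y , y∈B₂ , y∉B₁ ∘ I⊆B₁ , _ , isB , p⊆q∧x∈q⇒p∪⁅x⁆⊆q I⊆B₁-x∪y (q⊆p∪q (B₁ - x) ⁅ y ⁆ (x∈⁅x⁆ y))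
    where
    I⊆B₁-x∪y : I ⊆ (B₁ - x) ∪ ⁅ y ⁆
    I⊆B₁-x∪y w∈I = p⊆p∪q ⁅ y ⁆ (x∈p∧x≢y⇒x∈p-y (I⊆B₁ w∈I) λ { refl → x∉I w∈I })

  -- Bases form an undecidable family, so the rank of F ∪ {x} cannot be computed;
  -- flatness can only be used to refute a bound on it.
  flat-∪-outside⇒¬rank-bounded : ∀ {F} → IsFlat M F → IsRankOf (IsBasis M) F r → x ∉ F →
    ¬ (∀ B → IsBasis M B → ∣ (F ∪ ⁅ x ⁆) ∩ B ∣ ≤ r)
  flat-∪-outside⇒¬rank-bounded {x = x} {F} flat rank-F x∉F ≤r =
    1+n≰n (flat x x∉F _ _ rank-F (IsRankOf-⊇ rank-F (p⊆p∪q {p = F} ⁅ x ⁆) ≤r))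

module Hyperplane {n} (M : Matroid n) {h : ℕ} {H : Subset n} (rank-M : HasRank M (suc h))
  (flat : IsFlat M H) (rank-H : IsRankOf (IsBasis M) H h) where

  independent-⊆H⇒∣∣≢1+h : ∀ {I} → Independent M I → I ⊆ H → ∣ I ∣ ≢ suc h
  independent-⊆H⇒∣∣≢1+h indI I⊆H ∣I∣≡1+h =
    1+n≰n (subst (_≤ h) ∣I∣≡1+h (independent⇒∣∣≤rank M rank-H indI I⊆H))

  basis⊈H : ∀ {B} → IsBasis M B → ∃[ z ] (z ∈ B × z ∉ H)
  basis⊈H {B} isB with ⊆⊎∃∈∉ B H
  ... | inj₁ B⊆H = contradiction (∣basis∣≡rank M rank-M isB)
                                 (independent-⊆H⇒∣∣≢1+h (B , isB , ⊆-refl) B⊆H)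
  ... | inj₂ z∈B∖H = z∈B∖H

  -- Exchanging a point of B₂ ⊇ D outside H into B₁ adds a point of H ∪ {x} to D;
  -- it cannot lie in H, which has rank h, so it is x.
  basis-⊆H∪⁅x⁆⇒independent-∪⁅x⁆ : ∀ {D B₁} → Independent M D → D ⊆ H → ∣ D ∣ ≡ h → x ∉ H →
    IsBasis M B₁ → B₁ ⊆ H ∪ ⁅ x ⁆ → Independent M (D ∪ ⁅ x ⁆)
  basis-⊆H∪⁅x⁆⇒independent-∪⁅x⁆ {x = x} {D} (B₂ , isB₂ , D⊆B₂) D⊆H ∣D∣≡h x∉H isB₁ B₁⊆H∪x
    with x ∈? B₂
  ... | yes x∈B₂ = B₂ , isB₂ , p⊆q∧x∈q⇒p∪⁅x⁆⊆q D⊆B₂ x∈B₂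
  ... | no x∉B₂ with basis⊈H isB₂
  ... | z , z∈B₂ , z∉H
    with exchange-extends M isB₂ isB₁ D⊆B₂ z∈B₂ (z∉H ∘ D⊆H)
           (x∉p∧x∉q⇒x∉p∪q z∉H (x≢y⇒x∉⁅y⁆ λ { refl → x∉B₂ z∈B₂ }) ∘ B₁⊆H∪x)
  ... | y , y∈B₁ , y∉D , indD∪y with x∈p∪q⁻ H ⁅ x ⁆ (B₁⊆H∪x y∈B₁)
  ... | inj₁ y∈H = contradiction (trans (∣p∪⁅x⁆∣≡1+∣p∣ y∉D) (cong suc ∣D∣≡h))
                                 (independent-⊆H⇒∣∣≢1+h indD∪y (p⊆q∧x∈q⇒p∪⁅x⁆⊆q D⊆H y∈H))
  ... | inj₂ y∈⁅x⁆ rewrite x∈⁅y⁆⇒x≡y x y∈⁅x⁆ = indD∪y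

  ¬¬independent-∪⁅x⁆ : ∀ {D} → Independent M D → D ⊆ H → ∣ D ∣ ≡ h → x ∉ H →
    ¬ ¬ Independent M (D ∪ ⁅ x ⁆)
  ¬¬independent-∪⁅x⁆ {x = x} indD D⊆H ∣D∣≡h x∉H ¬indD∪x =
    flat-∪-outside⇒¬rank-bounded M flat rank-H x∉H bounded
    where
    bounded : ∀ B → IsBasis M B → ∣ (H ∪ ⁅ x ⁆) ∩ B ∣ ≤ h
    bounded B isB = decidable-stable (∣ (H ∪ ⁅ x ⁆) ∩ B ∣ ≤? h) λ ≰h →
      let ∣B∣≤∣H∪x∩B∣ = subst (_≤ ∣ (H ∪ ⁅ x ⁆) ∩ B ∣) (sym (∣basis∣≡rank M rank-M isB)) (≰⇒> ≰h)
      in ¬indD∪x (basis-⊆H∪⁅x⁆⇒independent-∪⁅x⁆ indD D⊆H ∣D∣≡h x∉H isB (∣q∣≤∣p∩q∣⇒q⊆p ∣B∣≤∣H∪x∩B∣))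

  module Stressed (stressed : ∀ S → S ⊆ H → ∣ S ∣ ≡ suc h → IsCircuit M S) where

    stressed-⊇-independent-of-size-h : ∀ {S} → S ⊆ H → ∣ S ∣ ≡ suc h →
      ∃[ D ] (D ⊆ S × Independent M D × ∣ D ∣ ≡ h)
    stressed-⊇-independent-of-size-h {S} S⊆H ∣S∣≡1+h =
      let s , s∈S = 0<∣p∣⇒Nonempty (subst (0 <_) (sym ∣S∣≡1+h) (s≤s z≤n))
      in S - s , p─q⊆p S ⁅ s ⁆ , proj₂ (stressed S S⊆H ∣S∣≡1+h) (S - s) (x∈p⇒p-x⊂p s∈S)
       , suc-injective (trans (x∈p⇒1+∣p-x∣≡∣p∣ s∈S) ∣S∣≡1+h)

    large-⊆H⇒rank≡h : ∀ {A} → A ⊆ H → suc h ≤ ∣ A ∣ → IsRankOf (IsBasis M) A r → r ≡ h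
    large-⊆H⇒rank≡h {r = r} A⊆H 1+h≤∣A∣ rank-A = ≤-antisym (IsRankOf-mono rank-A rank-H A⊆H) h≤r
      where
      h≤r : h ≤ r
      h≤r with s≤∣p∣⇒∃q⊆p∧∣q∣≡s 1+h≤∣A∣
      ... | S , S⊆A , ∣S∣≡1+h with stressed-⊇-independent-of-size-h (A⊆H ∘ S⊆A) ∣S∣≡1+h
      ... | D , D⊆S , indD , ∣D∣≡h =
        subst (_≤ r) ∣D∣≡h (independent⇒∣∣≤rank M rank-A indD (S⊆A ∘ D⊆S))

    ⊇stressed∪outside⇒1+h≤rank : ∀ {A S} → IsRankOf (IsBasis M) A r → S ⊆ A → S ⊆ H →
      ∣ S ∣ ≡ suc h → x ∈ A → x ∉ H → suc h ≤ r
    ⊇stressed∪outside⇒1+h≤rank {r = r} rank-A S⊆A S⊆H ∣S∣≡1+h x∈A x∉H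
      with stressed-⊇-independent-of-size-h S⊆H ∣S∣≡1+h
    ... | D , D⊆S , indD , ∣D∣≡h = decidable-stable (suc h ≤? r) λ 1+h≰r →
      ¬¬independent-∪⁅x⁆ indD (S⊆H ∘ D⊆S) ∣D∣≡h x∉H λ indD∪x →
        1+h≰r (subst (_≤ r) (trans (∣p∪⁅x⁆∣≡1+∣p∣ (x∉H ∘ S⊆H ∘ D⊆S)) (cong suc ∣D∣≡h))
                  (independent⇒∣∣≤rank M rank-A indD∪x (p⊆q∧x∈q⇒p∪⁅x⁆⊆q (S⊆A ∘ D⊆S) x∈A)))

    relaxed-rank-⊆H-large : ∀ {A} → A ⊆ H → suc h ≤ ∣ A ∣ → IsRankOf (IsBasis M) A r →
      IsRankOf (RelaxedBases M (suc h) H) A (suc r)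
    relaxed-rank-⊆H-large {r = r} {A} A⊆H 1+h≤∣A∣ rank-A with s≤∣p∣⇒∃q⊆p∧∣q∣≡s 1+h≤∣A∣
    ... | S , S⊆A , ∣S∣≡1+h =
      (S , inj₂ (A⊆H ∘ S⊆A , ∣S∣≡1+h) , trans (p⊆q⇒∣q∩p∣≡∣p∣ S⊆A) (trans ∣S∣≡1+h (cong suc (sym r≡h))))
      , ≤1+r
      where
      r≡h : r ≡ h
      r≡h = large-⊆H⇒rank≡h A⊆H 1+h≤∣A∣ rank-A
      ≤1+r : ∀ B → RelaxedBases M (suc h) H B → ∣ A ∩ B ∣ ≤ suc r
      ≤1+r B (inj₁ isB)        = ≤-trans (proj₂ rank-A B isB) (n≤1+n r)
      ≤1+r B (inj₂ (_ , ∣B∣≡1+h)) =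
        ≤-trans (∣p∩q∣≤∣q∣ A B) (≤-reflexive (trans ∣B∣≡1+h (cong suc (sym r≡h))))

    relaxed-rank-otherwise : ∀ {A} → ¬ (A ⊆ H × suc h ≤ ∣ A ∣) → IsRankOf (IsBasis M) A r →
      IsRankOf (RelaxedBases M (suc h) H) A r
    relaxed-rank-otherwise {r = r} {A} ¬A⊆H-large rank-A@((B₀ , isB₀ , ∣A∩B₀∣≡r) , ≤r) =
      (B₀ , inj₁ isB₀ , ∣A∩B₀∣≡r) , ≤r′
      where
      ≤r′ : ∀ B → RelaxedBases M (suc h) H B → ∣ A ∩ B ∣ ≤ r
      ≤r′ B (inj₁ isB) = ≤r B isB
      ≤r′ B (inj₂ (B⊆H , ∣B∣≡1+h)) with ⊆⊎∃∈∉ B A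
      ... | inj₂ (b , b∈B , b∉A) =
        independent⇒∣∣≤rank M rank-A
          (proj₂ (stressed B B⊆H ∣B∣≡1+h) (A ∩ B) (p∩q⊆q A B , b , b∈B , b∉A ∘ proj₁ ∘ x∈p∩q⁻ A B))
          (p∩q⊆p A B)
      ... | inj₁ B⊆A with ⊆⊎∃∈∉ A H
      ... | inj₁ A⊆H = ⊥-elim (¬A⊆H-large (A⊆H , subst (_≤ ∣ A ∣) ∣B∣≡1+h (p⊆q⇒∣p∣≤∣q∣ B⊆A)))
      ... | inj₂ (x , x∈A , x∉H) =
        ≤-trans (∣p∩q∣≤∣q∣ A B)
          (subst (_≤ r) (sym ∣B∣≡1+h) (⊇stressed∪outside⇒1+h≤rank rank-A B⊆A B⊆H ∣B∣≡1+h x∈A x∉H))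

proposition3p7 : ∀ {n} (M : Matroid n) (k : ℕ) (H : Subset n) →
    HasRank M k → IsStressedHyperplane M k H →
    ∀ (A : Subset n) (r : ℕ) → IsRankOf (IsBasis M) A r →
      ((A ⊆ H × k ≤ ∣ A ∣) → IsRankOf (RelaxedBases M k H) A (suc r)) ×
      (¬ (A ⊆ H × k ≤ ∣ A ∣) → IsRankOf (RelaxedBases M k H) A r)
proposition3p7 M _ H rank-M ((flat , h , refl , rank-H) , stressed) A r rank-A =
  (λ (A⊆H , 1+h≤∣A∣) → relaxed-rank-⊆H-large A⊆H 1+h≤∣A∣ rank-A) ,
  (λ ¬A⊆H-large → relaxed-rank-otherwise ¬A⊆H-large rank-A)
  where open Hyperplane M rank-M flat rank-H
        open Stressed stressed
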